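{- Let $G$ be a finite simple graph in which every cycle of even length is a $4$-cycle. Then $A_b(G)$ is the largest integer $k$ such that there exists an acyclic $k$-coloring of $G$ in which every color class $V_i$, $i\in[k]$, contains a weak acyclic b-vertex.
   Context: A (proper) $k$-coloring of $G$ is a map $c:V(G)\to[k]$ with $c(x)\neq c(y)$ for every edge $xy$, all $k$ colors used; color classes $V_i=c^{ -1}(i)$, $V_{j,\ell}=V_j\cup V_\ell$. A coloring is acyclic if $G[V_{j,\ell}]$ is a forest for all $j,\ell$. $CN_c(v)=\{c(u):u\in N_G(v)\}$, $CN_c[v]=CN_c(v)\cup\{c(v)\}$; $v$ is a b-vertex if $CN_c[v]=[k]$. A recoloring step applied to $c$ and a color $i$ having no b-vertex recolors every $v\in V_i$ with some color of $[k]\setminus CN_c[v]$, producing a $(k-1)$-coloring; if both colorings are acyclic it is an acyclic recoloring step. $A_b(G)$ is the maximum number of colors of an acyclic coloring of $G$ to which no acyclic recoloring step can be applied. A vertex $v\in V_i$ is a weak acyclic b-vertex if for every $\ell\in[k]\setminus CN_c[v]$ there exists $j\in CN_c(v)$ such that $G[V_{j,\ell}\cup\{v\}]$ contains a cycle. -}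

module Defs where

open import Data.Nat using (ℕ; zero; suc; _≤_)
open import Data.Nat.Divisibility using (_∣_)
open import Data.Fin using (Fin; zero; suc; inject₁; fromℕ)
open import Data.Unit using (⊤)
open import Data.Bool using (Bool; true; false)
open import Data.Product using (Σ; ∃; _×_; _,_)
open import Data.Sum using (_⊎_)
open import Function.Definitions using (Injective)
open import Relation.Binary.PropositionalEquality using (_≡_; _≢_)
open import Relation.Nullary using (¬_)
open import Function.Bundles using (_⇔_)

record Graph (n : ℕ) : Set where
  field
    adj    : Fin n → Fin n → Bool
    sym    : ∀ x y → adj x y ≡ adj y x
    irrefl : ∀ x → adj x x ≡ false

open Graph public

Edge : ∀ {n} → Graph n → Fin n → Fin n → Set
Edge G x y = adj G x y ≡ true

record CycleIn {n : ℕ} (G : Graph n) (S : Fin n → Set) (len : ℕ) : Set where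
  field
    m      : ℕ
    len≡   : len ≡ suc m
    long   : 3 ≤ suc m
    w      : Fin (suc m) → Fin n
    inj    : Injective _≡_ _≡_ w
    inS    : ∀ i → S (w i)
    step   : ∀ (i : Fin m) → Edge G (w (inject₁ i)) (w (suc i))
    close  : Edge G (w (fromℕ m)) (w zero)

HasCycle : ∀ {n} → Graph n → (Fin n → Set) → Set
HasCycle G S = ∃ λ len → CycleIn G S len

EvenCyclesAre4 : ∀ {n} → Graph n → Set
EvenCyclesAre4 {n} G = ∀ len → CycleIn G (λ _ → ⊤) len → 2 ∣ len → len ≡ 4

V2 : ∀ {n k} → (Fin n → Fin k) → Fin k → Fin k → Fin n → Set
V2 c j l u = c u ≡ j ⊎ c u ≡ l

Acyclic : ∀ {n k} → Graph n → (Fin n → Fin k) → Set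
Acyclic G c = ∀ j l → ¬ HasCycle G (V2 c j l)

module _ {n : ℕ} (G : Graph n) {k : ℕ} (c : Fin n → Fin k) where

  IsColoring : Set
  IsColoring = (∀ x y → Edge G x y → c x ≢ c y) × (∀ i → ∃ λ v → c v ≡ i)


  InCN : Fin n → Fin k → Set
  InCN v j = ∃ λ u → Edge G v u × c u ≡ j

  InCN[] : Fin n → Fin k → Set
  InCN[] v j = c v ≡ j ⊎ InCN v j

  IsBVertex : Fin n → Set
  IsBVertex v = ∀ j → InCN[] v j

  WeakAcyclicBVertex : Fin n → Set
  WeakAcyclicBVertex v =
    ∀ l → ¬ InCN[] v l →
      ∃ λ j → InCN v j × HasCycle G (λ u → V2 c j l u ⊎ u ≡ v)

  NoBVertexIn : Fin k → Set
  NoBVertexIn i = ∀ v → c v ≡ i → ¬ IsBVertex v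

  -- c' is obtained from c by a recoloring step on colour i: vertices outside V_i
  -- keep their colour, every v ∈ V_i gets a colour of [k] ∖ CN_c[v].
  -- (c' takes values in [k] ∖ {i}; as a (k-1)-colouring it is c' followed by the
  -- order-preserving relabelling of [k] ∖ {i} onto [k-1], which does not affect
  -- properness or acyclicity.)
  RecoloringOf : Fin k → (Fin n → Fin k) → Set
  RecoloringOf i c' = (∀ v → c v ≢ i → c' v ≡ c v) × (∀ v → c v ≡ i → ¬ InCN[] v (c' v))

  AcyclicStepApplicable : Set
  AcyclicStepApplicable =
    ∃ λ i → NoBVertexIn i × ∃ λ c' → RecoloringOf i c' × Acyclic G c'

AbCandidate : ∀ {n} → Graph n → ℕ → Set
AbCandidate {n} G k = ∃ λ (c : Fin n → Fin k) →
  IsColoring G c × Acyclic G c × ¬ AcyclicStepApplicable G c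

WeakCandidate : ∀ {n} → Graph n → ℕ → Set
WeakCandidate {n} G k = ∃ λ (c : Fin n → Fin k) →
  IsColoring G c × Acyclic G c × (∀ i → ∃ λ v → c v ≡ i × WeakAcyclicBVertex G c v)

IsMax : (ℕ → Set) → ℕ → Set
IsMax P m = P m × (∀ k → P k → k ≤ m)

IsAb : ∀ {n} → Graph n → ℕ → Set
IsAb G = IsMax (AbCandidate G)

{-# OPTIONS --safe #-}
-- A weak acyclic b-vertex v of colour i blocks every acyclic recolouring of V_i, in any
-- graph: whichever missing colour l the vertex v receives, the cycle of G[V_{j,l} ∪ {v}]
-- becomes a cycle in the new class pair V_{j,l}.
--
-- Conversely, in a proper colouring every cycle inside some V_{a,b} alternates colours, so
-- it is even, hence a 4-cycle when all even cycles are 4-cycles. Call v a square b-vertex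
-- if each missing colour l is the colour of a common neighbour w of two equally coloured
-- neighbours u₁, u₂ of v; then v u₁ w u₂ is a cycle witnessing that v is a weak acyclic
-- b-vertex. If V_i contains no square b-vertex, recolour each v ∈ V_i with a missing colour
-- that closes no such square. The result is proper, and a bicoloured 4-cycle of it would
-- either avoid V_i (a cycle for c), meet V_i in two opposite corners (a cycle in some
-- V_{i,j} for c), or meet V_i in a single corner closing one of the excluded squares.
module Submission where

open import Defs hiding (sym)
open import Data.Nat using (ℕ; zero; suc; s≤s; z≤n)
open import Data.Nat.Divisibility using (_∣_; _∣0; ∣-refl; ∣m∣n⇒∣m+n)
open import Data.Fin using (Fin; zero; suc; inject₁; fromℕ; _≟_)
open import Data.Fin.Properties using (any?; all?; ¬∀⟶∃¬)
open import Data.Unit using (tt)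
open import Data.Empty using (⊥; ⊥-elim)
open import Data.Product using (Σ; ∃; _×_; _,_; proj₁; proj₂)
open import Data.Sum using (_⊎_; inj₁; inj₂; map)
open import Function using (_∘_; case_of_)
open import Function.Definitions using (Injective)
open import Function.Bundles using (_⇔_; mk⇔; Equivalence)
open import Relation.Nullary using (¬_; Dec; yes; no)
open import Relation.Nullary.Decidable using (_×-dec_; _⊎-dec_; _→-dec_; ¬?)
open import Relation.Binary.PropositionalEquality using (_≡_; _≢_; refl; sym; trans; cong; subst)
import Data.Bool as Bool

Proper : ∀ {n} → Graph n → ∀ {k} → (Fin n → Fin k) → Set
Proper G c = ∀ x y → Edge G x y → c x ≢ c y

module _ {n} (G : Graph n) where

  edge? : ∀ x y → Dec (Edge G x y)
  edge? x y = adj G x y Bool.≟ Bool.true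

  edge-sym : ∀ {x y} → Edge G x y → Edge G y x
  edge-sym {x} {y} e = trans (Graph.sym G y x) e

  edge⇒≢ : ∀ {x y} → Edge G x y → x ≢ y
  edge⇒≢ {x} e refl with trans (sym e) (irrefl G x)
  ... | ()

  cycle-mono : ∀ {S T : Fin n → Set} {len} → (∀ {x} → S x → T x) →
    CycleIn G S len → CycleIn G T len
  cycle-mono S⊆T record { m = m ; len≡ = len≡ ; long = long ; w = w ; inj = inj ; inS = inS ; step = step ; close = close } =
    record { m = m ; len≡ = len≡ ; long = long ; w = w ; inj = inj ; inS = S⊆T ∘ inS ; step = step ; close = close }

next : Fin 4 → Fin 4
next zero                   = suc zero
next (suc zero)             = suc (suc zero)
next (suc (suc zero))       = suc (suc (suc zero))
next (suc (suc (suc zero))) = zero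

prev : Fin 4 → Fin 4
prev zero                   = suc (suc (suc zero))
prev (suc zero)             = zero
prev (suc (suc zero))       = suc zero
prev (suc (suc (suc zero))) = suc (suc zero)

prev-next : ∀ t → prev (next t) ≡ t
prev-next zero                   = refl
prev-next (suc zero)             = refl
prev-next (suc (suc zero))       = refl
prev-next (suc (suc (suc zero))) = refl

next-injective : Injective _≡_ _≡_ next
next-injective {t} {u} next-t≡next-u =
  trans (sym (prev-next t)) (trans (cong prev next-t≡next-u) (prev-next u))

record Square {n} (G : Graph n) (S : Fin n → Set) : Set where
  field
    corner           : Fin 4 → Fin n
    corner-injective : Injective _≡_ _≡_ corner
    side             : ∀ t → Edge G (corner t) (corner (next t))
    corner∈          : ∀ t → S (corner t)

module _ {n} {G : Graph n} where

  open Square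

  square⇒cycle : ∀ {S} → Square G S → HasCycle G S
  square⇒cycle sq = 4 , record
    { m = 3 ; len≡ = refl ; long = s≤s (s≤s (s≤s z≤n))
    ; w = corner sq ; inj = corner-injective sq ; inS = corner∈ sq
    ; step = step ; close = side sq (suc (suc (suc zero))) }
    where
    step : ∀ (t : Fin 3) → Edge G (corner sq (inject₁ t)) (corner sq (suc t))
    step zero             = side sq zero
    step (suc zero)       = side sq (suc zero)
    step (suc (suc zero)) = side sq (suc (suc zero))

  cycle₄⇒square : ∀ {S} → CycleIn G S 4 → Square G S
  cycle₄⇒square record { len≡ = refl ; w = w ; inj = inj ; inS = inS ; step = step ; close = close } =
    record { corner = w ; corner-injective = inj ; side = sides ; corner∈ = inS }
    where
    sides : ∀ t → Edge G (w t) (w (next t))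
    sides zero                   = step zero
    sides (suc zero)             = step (suc zero)
    sides (suc (suc zero))       = step (suc (suc zero))
    sides (suc (suc (suc zero))) = close

  square-within : ∀ {S T} (sq : Square G S) → (∀ t → T (corner sq t)) → Square G T
  square-within sq T∋corner = record
    { corner = corner sq ; corner-injective = corner-injective sq ; side = side sq ; corner∈ = T∋corner }

  rotate : ∀ {S} → Square G S → Square G S
  rotate sq = record
    { corner = corner sq ∘ next
    ; corner-injective = next-injective ∘ corner-injective sq
    ; side = side sq ∘ next
    ; corner∈ = corner∈ sq ∘ next }

  rotate-to : ∀ {S} (sq : Square G S) t → Σ (Square G S) λ sq′ → corner sq′ zero ≡ corner sq t
  rotate-to sq zero                   = sq , refl
  rotate-to sq (suc zero)             = rotate sq , refl
  rotate-to sq (suc (suc zero))       = rotate (rotate sq) , refl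
  rotate-to sq (suc (suc (suc zero))) = rotate (rotate (rotate sq)) , refl

  square-from-corners : ∀ {S} (x₀ x₁ x₂ x₃ : Fin n) →
    x₀ ≢ x₁ → x₀ ≢ x₂ → x₀ ≢ x₃ → x₁ ≢ x₂ → x₁ ≢ x₃ → x₂ ≢ x₃ →
    Edge G x₀ x₁ → Edge G x₁ x₂ → Edge G x₂ x₃ → Edge G x₃ x₀ →
    S x₀ → S x₁ → S x₂ → S x₃ → Square G S
  square-from-corners {S} x₀ x₁ x₂ x₃ d₀₁ d₀₂ d₀₃ d₁₂ d₁₃ d₂₃ e₀₁ e₁₂ e₂₃ e₃₀ s₀ s₁ s₂ s₃ =
    record { corner = x ; corner-injective = x-injective ; side = sides ; corner∈ = x∈ }
    where
    x : Fin 4 → Fin n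
    x zero                   = x₀
    x (suc zero)             = x₁
    x (suc (suc zero))       = x₂
    x (suc (suc (suc zero))) = x₃

    x-injective : Injective _≡_ _≡_ x
    x-injective {zero}                 {zero}                 _ = refl
    x-injective {zero}                 {suc zero}             e = ⊥-elim (d₀₁ e)
    x-injective {zero}                 {suc (suc zero)}       e = ⊥-elim (d₀₂ e)
    x-injective {zero}                 {suc (suc (suc zero))} e = ⊥-elim (d₀₃ e)
    x-injective {suc zero}             {zero}                 e = ⊥-elim (d₀₁ (sym e))
    x-injective {suc zero}             {suc zero}             _ = refl
    x-injective {suc zero}             {suc (suc zero)}       e = ⊥-elim (d₁₂ e)
    x-injective {suc zero}             {suc (suc (suc zero))} e = ⊥-elim (d₁₃ e)
    x-injective {suc (suc zero)}       {zero}                 e = ⊥-elim (d₀₂ (sym e))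
    x-injective {suc (suc zero)}       {suc zero}             e = ⊥-elim (d₁₂ (sym e))
    x-injective {suc (suc zero)}       {suc (suc zero)}       _ = refl
    x-injective {suc (suc zero)}       {suc (suc (suc zero))} e = ⊥-elim (d₂₃ e)
    x-injective {suc (suc (suc zero))} {zero}                 e = ⊥-elim (d₀₃ (sym e))
    x-injective {suc (suc (suc zero))} {suc zero}             e = ⊥-elim (d₁₃ (sym e))
    x-injective {suc (suc (suc zero))} {suc (suc zero)}       e = ⊥-elim (d₂₃ (sym e))
    x-injective {suc (suc (suc zero))} {suc (suc (suc zero))} _ = refl

    sides : ∀ t → Edge G (x t) (x (next t))
    sides zero                   = e₀₁
    sides (suc zero)             = e₁₂
    sides (suc (suc zero))       = e₂₃
    sides (suc (suc (suc zero))) = e₃₀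

    x∈ : ∀ t → S (x t)
    x∈ zero                   = s₀
    x∈ (suc zero)             = s₁
    x∈ (suc (suc zero))       = s₂
    x∈ (suc (suc (suc zero))) = s₃

alternate : ∀ {k} {a b p q r : Fin k} → p ≡ a ⊎ p ≡ b → q ≡ a ⊎ q ≡ b → r ≡ a ⊎ r ≡ b →
  p ≢ q → q ≢ r → p ≡ r
alternate (inj₁ refl) (inj₁ refl) _           p≢q _   = ⊥-elim (p≢q refl)
alternate (inj₁ refl) (inj₂ refl) (inj₁ refl) _   _   = refl
alternate (inj₁ refl) (inj₂ refl) (inj₂ refl) _   q≢r = ⊥-elim (q≢r refl)
alternate (inj₂ refl) (inj₁ refl) (inj₁ refl) _   q≢r = ⊥-elim (q≢r refl)
alternate (inj₂ refl) (inj₁ refl) (inj₂ refl) _   _   = refl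
alternate (inj₂ refl) (inj₂ refl) _           p≢q _   = ⊥-elim (p≢q refl)

module _ {n} {G : Graph n} {k} {c : Fin n → Fin k} (proper : Proper G c) {a b : Fin k} where

  walk-parity : ∀ m (w : Fin (suc m) → Fin n) → (∀ t → V2 c a b (w t)) →
    (∀ (t : Fin m) → Edge G (w (inject₁ t)) (w (suc t))) →
    (c (w (fromℕ m)) ≡ c (w zero) × 2 ∣ m) ⊎ (c (w (fromℕ m)) ≢ c (w zero) × 2 ∣ suc m)
  walk-parity zero    w w∈ step = inj₁ (refl , 2 ∣0)
  walk-parity (suc m) w w∈ step with walk-parity m (w ∘ inject₁) (w∈ ∘ inject₁) (step ∘ inject₁)
  ... | inj₁ (same , 2∣m) =
    inj₂ ((λ same′ → proper _ _ (step (fromℕ m)) (trans same (sym same′))) , ∣m∣n⇒∣m+n ∣-refl 2∣m)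
  ... | inj₂ (differ , 2∣1+m) =
    inj₁ (alternate (w∈ _) (w∈ _) (w∈ zero) (proper _ _ (edge-sym G (step (fromℕ m)))) differ , 2∣1+m)

  bicoloured-cycle-even : ∀ {len} → CycleIn G (V2 c a b) len → 2 ∣ len
  bicoloured-cycle-even record { m = m ; len≡ = len≡ ; w = w ; inS = w∈ ; step = step ; close = close }
    with walk-parity m w w∈ step
  ... | inj₁ (same , _)   = ⊥-elim (proper _ _ close same)
  ... | inj₂ (_ , 2∣1+m) = subst (2 ∣_) (sym len≡) 2∣1+m

  bicoloured-cycle⇒square : EvenCyclesAre4 G → HasCycle G (V2 c a b) → Square G (V2 c a b)
  bicoloured-cycle⇒square evenCycles (len , cy)
    with evenCycles len (cycle-mono G (λ _ → tt) cy) (bicoloured-cycle-even cy)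
  ... | refl = cycle₄⇒square cy

weak-b-vertices⇒no-acyclic-step : ∀ {n} {G : Graph n} {k} {c : Fin n → Fin k} → Proper G c →
  (∀ i → ∃ λ v → c v ≡ i × WeakAcyclicBVertex G c v) → ¬ AcyclicStepApplicable G c
weak-b-vertices⇒no-acyclic-step {G = G} {c = c} proper weak (i , _ , c′ , (keep , missing) , acyclic′)
  with weak i
... | v , refl , v-weak with v-weak (c′ v) (missing v refl)
... | j , (u , v~u , refl) , (len , cy) = acyclic′ (c u) (c′ v) (len , cycle-mono G recoloured cy)
  where
  recoloured : ∀ {x} → V2 c (c u) (c′ v) x ⊎ x ≡ v → V2 c′ (c u) (c′ v) x
  recoloured (inj₂ refl) = inj₂ refl
  recoloured {x} (inj₁ (inj₁ cx≡cu)) =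
    inj₁ (trans (keep x (λ cx≡cv → proper v u v~u (trans (sym cx≡cv) cx≡cu))) cx≡cu)
  recoloured {x} (inj₁ (inj₂ cx≡l)) =
    inj₂ (trans (keep x (λ cx≡cv → missing v refl (inj₁ (trans (sym cx≡cv) cx≡l)))) cx≡l)

module _ {n} (G : Graph n) {k} (c : Fin n → Fin k) where

  SquareAt : Fin n → Fin k → Set
  SquareAt v l = Σ (Fin n) λ u₁ → Σ (Fin n) λ u₂ → Σ (Fin n) λ w →
    Edge G v u₁ × Edge G v u₂ × u₁ ≢ u₂ × c u₁ ≡ c u₂ × c w ≡ l × Edge G u₁ w × Edge G u₂ w

  SquareBVertex : Fin n → Set
  SquareBVertex v = ∀ l → ¬ InCN[] G c v l → SquareAt v l

  InCN? : ∀ v l → Dec (InCN G c v l)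
  InCN? v l = any? λ u → edge? G v u ×-dec (c u ≟ l)

  InCN[]? : ∀ v l → Dec (InCN[] G c v l)
  InCN[]? v l = (c v ≟ l) ⊎-dec InCN? v l

  SquareAt? : ∀ v l → Dec (SquareAt v l)
  SquareAt? v l = any? λ u₁ → any? λ u₂ → any? λ w →
    edge? G v u₁ ×-dec (edge? G v u₂ ×-dec (¬? (u₁ ≟ u₂) ×-dec (c u₁ ≟ c u₂ ×-dec
      (c w ≟ l ×-dec (edge? G u₁ w ×-dec edge? G u₂ w)))))

  SquareBVertex? : ∀ v → Dec (SquareBVertex v)
  SquareBVertex? v = all? λ l → ¬? (InCN[]? v l) →-dec SquareAt? v l

  missing-colour-without-square : ∀ v → ¬ SquareBVertex v →
    Σ (Fin k) λ l → ¬ InCN[] G c v l × ¬ SquareAt v l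
  missing-colour-without-square v ¬square
    with ¬∀⟶∃¬ k _ (λ l → ¬? (InCN[]? v l) →-dec SquareAt? v l) ¬square
  ... | l , ¬implication with InCN[]? v l
  ...   | yes present = ⊥-elim (¬implication (λ absent → ⊥-elim (absent present)))
  ...   | no absent   = l , absent , λ square → ¬implication (λ _ → square)

  square-b-vertex⇒weak : ∀ v → SquareBVertex v → WeakAcyclicBVertex G c v
  square-b-vertex⇒weak v square l absent
    with square l absent
  ... | u₁ , u₂ , w , v~u₁ , v~u₂ , u₁≢u₂ , cu₁≡cu₂ , refl , u₁~w , u₂~w =
    c u₁ , (u₁ , v~u₁ , refl) , square⇒cycle (square-from-corners v u₁ w u₂
      (edge⇒≢ G v~u₁) v≢w (edge⇒≢ G v~u₂) (edge⇒≢ G u₁~w) u₁≢u₂ (edge⇒≢ G (edge-sym G u₂~w))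
      v~u₁ u₁~w (edge-sym G u₂~w) (edge-sym G v~u₂)
      (inj₂ refl) (inj₁ (inj₁ refl)) (inj₁ (inj₂ refl)) (inj₁ (inj₁ (sym cu₁≡cu₂))))
    where
    v≢w : v ≢ w
    v≢w refl = absent (inj₁ refl)

module Recolouring {n} {G : Graph n} (evenCycles : EvenCyclesAre4 G) {k} {c : Fin n → Fin k}
  (proper : Proper G c) (acyclic : Acyclic G c) (i : Fin k)
  (choose : ∀ v → c v ≡ i → Σ (Fin k) λ l → ¬ InCN[] G c v l × ¬ SquareAt G c v l) where

  open Square

  recolour : Fin n → Fin k
  recolour v with c v ≟ i
  ... | yes cv≡i = proj₁ (choose v cv≡i)
  ... | no  _    = c v

  recolour-outside : ∀ v → c v ≢ i → recolour v ≡ c v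
  recolour-outside v cv≢i with c v ≟ i
  ... | yes cv≡i = ⊥-elim (cv≢i cv≡i)
  ... | no  _    = refl

  recolour-inside : ∀ v → c v ≡ i → ¬ InCN[] G c v (recolour v) × ¬ SquareAt G c v (recolour v)
  recolour-inside v cv≡i with c v ≟ i
  ... | yes cv≡i′ = proj₂ (choose v cv≡i′)
  ... | no  cv≢i  = ⊥-elim (cv≢i cv≡i)

  recolouring : RecoloringOf G c i recolour
  recolouring = recolour-outside , λ v cv≡i → proj₁ (recolour-inside v cv≡i)

  no-b-vertex : NoBVertexIn G c i
  no-b-vertex v cv≡i b-vertex = proj₁ (proj₂ (choose v cv≡i)) (b-vertex _)

  neighbour-outside : ∀ {x y} → Edge G x y → c x ≡ i → c y ≢ i
  neighbour-outside {x} {y} x~y cx≡i cy≡i = proper x y x~y (trans cx≡i (sym cy≡i))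

  recoloured≢neighbour : ∀ {x y} → Edge G x y → c x ≡ i → c y ≢ i → recolour x ≢ recolour y
  recoloured≢neighbour {x} {y} x~y cx≡i cy≢i same =
    proj₁ (recolour-inside x cx≡i) (inj₂ (y , x~y , trans (sym (recolour-outside y cy≢i)) (sym same)))

  recolour-proper : Proper G recolour
  recolour-proper x y x~y = by-cases (c x ≟ i) (c y ≟ i)
    where
    by-cases : Dec (c x ≡ i) → Dec (c y ≡ i) → recolour x ≢ recolour y
    by-cases (yes cx≡i) (yes cy≡i) = ⊥-elim (neighbour-outside x~y cx≡i cy≡i)
    by-cases (yes cx≡i) (no cy≢i)  = recoloured≢neighbour x~y cx≡i cy≢i
    by-cases (no cx≢i)  (yes cy≡i) = recoloured≢neighbour (edge-sym G x~y) cy≡i cx≢i ∘ sym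
    by-cases (no cx≢i)  (no cy≢i)  = λ same → proper x y x~y
      (trans (sym (recolour-outside x cx≢i)) (trans same (recolour-outside y cy≢i)))

  module _ {a b : Fin k} where

    square-through-recoloured : (sq : Square G (V2 recolour a b)) → c (corner sq zero) ≢ i
    square-through-recoloured sq c₀≡i = by-opposite-corner (c x₂ ≟ i)
      where
      x₀ x₁ x₂ x₃ : Fin n
      x₀ = corner sq zero
      x₁ = corner sq (suc zero)
      x₂ = corner sq (suc (suc zero))
      x₃ = corner sq (suc (suc (suc zero)))

      c₁≢i : c x₁ ≢ i
      c₁≢i = neighbour-outside (side sq zero) c₀≡i

      c₃≢i : c x₃ ≢ i
      c₃≢i = neighbour-outside (edge-sym G (side sq (suc (suc (suc zero))))) c₀≡i

      c₁≡c₃ : c x₁ ≡ c x₃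
      c₁≡c₃ = trans (sym (recolour-outside x₁ c₁≢i)) (trans
        (alternate (corner∈ sq (suc zero)) (corner∈ sq zero) (corner∈ sq (suc (suc (suc zero))))
          (recolour-proper x₁ x₀ (edge-sym G (side sq zero)))
          (recolour-proper x₀ x₃ (edge-sym G (side sq (suc (suc (suc zero)))))))
        (recolour-outside x₃ c₃≢i))

      recolour₀≡recolour₂ : recolour x₀ ≡ recolour x₂
      recolour₀≡recolour₂ = alternate (corner∈ sq zero) (corner∈ sq (suc zero)) (corner∈ sq (suc (suc zero)))
        (recolour-proper x₀ x₁ (side sq zero)) (recolour-proper x₁ x₂ (side sq (suc zero)))

      by-opposite-corner : Dec (c x₂ ≡ i) → ⊥
      by-opposite-corner (yes c₂≡i) = acyclic i (c x₁) (square⇒cycle (square-within sq in-V₁))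
        where
        in-V₁ : ∀ t → V2 c i (c x₁) (corner sq t)
        in-V₁ zero                   = inj₁ c₀≡i
        in-V₁ (suc zero)             = inj₂ refl
        in-V₁ (suc (suc zero))       = inj₁ c₂≡i
        in-V₁ (suc (suc (suc zero))) = inj₂ (sym c₁≡c₃)
      by-opposite-corner (no c₂≢i) = proj₂ (recolour-inside x₀ c₀≡i)
        (x₁ , x₃ , x₂ , side sq zero , edge-sym G (side sq (suc (suc (suc zero))))
        , (λ x₁≡x₃ → case corner-injective sq x₁≡x₃ of λ ())
        , c₁≡c₃ , trans (sym (recolour-outside x₂ c₂≢i)) (sym recolour₀≡recolour₂)
        , side sq (suc zero) , edge-sym G (side sq (suc (suc zero))))

    no-bicoloured-square : ¬ Square G (V2 recolour a b)
    no-bicoloured-square sq with any? (λ t → c (corner sq t) ≟ i)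
    ... | yes (t , ct≡i) =
      let (sq′ , same-corner) = rotate-to sq t
      in square-through-recoloured sq′ (trans (cong c same-corner) ct≡i)
    ... | no avoids = acyclic a b (square⇒cycle (square-within sq λ t →
      unchanged (λ ct≡i → avoids (t , ct≡i)) (corner∈ sq t)))
      where
      unchanged : ∀ {x} → c x ≢ i → V2 recolour a b x → V2 c a b x
      unchanged {x} cx≢i = let recolour≡c = sym (recolour-outside x cx≢i) in
        map (trans recolour≡c) (trans recolour≡c)

  recolour-acyclic : Acyclic G recolour
  recolour-acyclic a b cycle =
    no-bicoloured-square (bicoloured-cycle⇒square recolour-proper evenCycles cycle)

  acyclic-step : AcyclicStepApplicable G c
  acyclic-step = i , no-b-vertex , recolour , recolouring , recolour-acyclic

no-acyclic-step⇒weak-b-vertices : ∀ {n} {G : Graph n} → EvenCyclesAre4 G → ∀ {k} {c : Fin n → Fin k} →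
  Proper G c → Acyclic G c → ¬ AcyclicStepApplicable G c →
  ∀ i → ∃ λ v → c v ≡ i × WeakAcyclicBVertex G c v
no-acyclic-step⇒weak-b-vertices {G = G} evenCycles {c = c} proper acyclic no-step i
  with any? (λ v → (c v ≟ i) ×-dec SquareBVertex? G c v)
... | yes (v , cv≡i , square) = v , cv≡i , square-b-vertex⇒weak G c v square
... | no none = ⊥-elim (no-step (Recolouring.acyclic-step evenCycles proper acyclic i choose))
  where
  choose : ∀ v → c v ≡ i → Σ (Fin _) λ l → ¬ InCN[] G c v l × ¬ SquareAt G c v l
  choose v cv≡i = missing-colour-without-square G c v (λ square → none (v , cv≡i , square))

ab-candidate⇔weak-candidate : ∀ {n} {G : Graph n} → EvenCyclesAre4 G →
  ∀ k → AbCandidate G k ⇔ WeakCandidate G k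
ab-candidate⇔weak-candidate evenCycles k = mk⇔
  (λ (c , colouring , acyclic , no-step) →
    c , colouring , acyclic , no-acyclic-step⇒weak-b-vertices evenCycles (proj₁ colouring) acyclic no-step)
  (λ (c , colouring , acyclic , weak) →
    c , colouring , acyclic , weak-b-vertices⇒no-acyclic-step (proj₁ colouring) weak)

IsMax-cong : ∀ {P Q : ℕ → Set} → (∀ k → P k ⇔ Q k) → ∀ m → IsMax P m ⇔ IsMax Q m
IsMax-cong P⇔Q m = mk⇔
  (λ (Pm , bound) → Equivalence.to (P⇔Q m) Pm , λ k Qk → bound k (Equivalence.from (P⇔Q k) Qk))
  (λ (Qm , bound) → Equivalence.from (P⇔Q m) Qm , λ k Pk → bound k (Equivalence.to (P⇔Q k) Pk))

corollary2 : ∀ {n} (G : Graph n) → EvenCyclesAre4 G →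
    ∀ (m : ℕ) → IsAb G m ⇔ IsMax (WeakCandidate G) m
corollary2 G evenCycles = IsMax-cong (ab-candidate⇔weak-candidate evenCycles)
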